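{- Let $n\geq 2$ and let $D_n\subseteq\mathbb{Q}^n$ be topologically dense with no two distinct points colinear. Let $\mathbf{P}\subseteq\mathbf{Q}$ be structures in $\mathcal{PO}_{n,<_1,\ldots,<_n}$ ($\mathbf{P}$ a substructure of $\mathbf{Q}$). If $f$ is an embedding of $\mathbf{P}$ into $\mathbf{D}_{n,<_1,\ldots,<_n}=(D_n,<,<_1,\ldots,<_n)$, then there is an embedding $g$ of $\mathbf{Q}$ into $\mathbf{D}_{n,<_1,\ldots,<_n}$ extending $f$.
   Context: $\mathbb{Q}^n$ has the product topology and product order ($\mathbf{a}<\mathbf{b}$ iff $a_i\leq b_i$ for all $i$ and $\mathbf{a}\neq\mathbf{b}$). Colinear means sharing a coordinate. On $D_n$, $<$ is the restricted product order and $\mathbf{a}<_i\mathbf{b}\iff a_i<b_i$. An $n$-dimensional partial order with realizers is a structure $(P,<,<_1,\ldots,<_n)$, $P\neq\emptyset$, each $<_i$ a strict linear order on $P$ and $a<b$ iff $a<_i b$ for all $i$; $\mathcal{PO}_{n,<_1,\ldots,<_n}$ is the class of finite ones. Embeddings are injective maps preserving and reflecting all $n+1$ relations; substructures carry the induced relations. -}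

module Defs where

open import Data.Nat using (ℕ; suc)
open import Data.Fin using (Fin)
open import Data.Rational using (ℚ) renaming (_<_ to _<ℚ_; _≤_ to _≤ℚ_)
open import Data.Vec using (Vec; lookup)
open import Data.Product using (Σ; ∃; ∃-syntax; _×_; _,_)
open import Relation.Binary using (IsStrictTotalOrder)
open import Relation.Binary.PropositionalEquality using (_≡_; _≢_)
open import Relation.Nullary using (¬_)

-- Points of ℚ^n (as vectors so that equality of points is the usual one).
Point : ℕ → Set
Point n = Vec ℚ n

Dense : ∀ {n} → (Point n → Set) → Set
Dense {n} D =
  (a b : Point n) → (∀ i → lookup a i <ℚ lookup b i) →
  ∃[ d ] (D d × (∀ i → (lookup a i <ℚ lookup d i) × (lookup d i <ℚ lookup b i)))

Colinear : ∀ {n} → Point n → Point n → Set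
Colinear {n} x y = ∃[ i ] (lookup x i ≡ lookup y i)

NoColinear : ∀ {n} → (Point n → Set) → Set
NoColinear D = ∀ x y → D x → D y → x ≢ y → ¬ Colinear x y

_<ₚ_ : ∀ {n} → Point n → Point n → Set
a <ₚ b = (∀ i → lookup a i ≤ℚ lookup b i) × (a ≢ b)

_<[_]ₚ_ : ∀ {n} → Point n → Fin n → Point n → Set
a <[ i ]ₚ b = lookup a i <ℚ lookup b i

record POn (n : ℕ) : Set₁ where
  field
    pred-size : ℕ
  size : ℕ
  size = suc pred-size
  field
    _<[_]_ : Fin size → Fin n → Fin size → Set
    isSTO  : ∀ i → IsStrictTotalOrder _≡_ (λ x y → x <[ i ] y)
  _≺_ : Fin size → Fin size → Set
  x ≺ y = ∀ i → x <[ i ] y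

open POn public

-- f, defined on the elements x of Q with Dom x (the induced substructure),
-- is an embedding into (D, <, <_1, ..., <_n): lands in D, injective,
-- preserves and reflects < and every <_i.
IsEmbeddingOn : ∀ {n} (Q : POn n) (D : Point n → Set)
  (Dom : Fin (size Q) → Set) (f : (x : Fin (size Q)) → Dom x → Point n) → Set
IsEmbeddingOn {n} Q D Dom f =
  ((x : Fin (size Q)) (p : Dom x) → D (f x p)) ×
  ((x y : Fin (size Q)) (p : Dom x) (q : Dom y) → f x p ≡ f y q → x ≡ y) ×
  ((x y : Fin (size Q)) (p : Dom x) (q : Dom y) →
     ((_≺_ Q x y → f x p <ₚ f y q) × (f x p <ₚ f y q → _≺_ Q x y))) ×
  ((x y : Fin (size Q)) (p : Dom x) (q : Dom y) (i : Fin n) →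
     ((_<[_]_ Q x i y → f x p <[ i ]ₚ f y q) × (f x p <[ i ]ₚ f y q → _<[_]_ Q x i y)))

-- Call a map h from Q to ℚⁿ realizer-preserving if it lands in D and y <ᵢ z implies
-- h(y)ᵢ < h(z)ᵢ for every i. Because the realizers are linear orders, such a map
-- also reflects every <ᵢ and the product order and is injective, i.e. it is an
-- embedding. A realizer-preserving partial map extends to one more point x: in each
-- coordinate i the values h(y)ᵢ with y <ᵢ x lie below those with x <ᵢ y, so they
-- are separated by an open interval, and density gives a point of D in the product
-- of these intervals. Adding the points of Q one at a time extends f to all of Q.
module Submission where

open import Defs
open import Data.Nat using (ℕ; _≤_)
open import Data.Fin using (Fin; _≟_; fromℕ<)
open import Data.Fin.Subset using (Subset; _∈_; Nonempty)
open import Data.Fin.Subset.Properties using (_∈?_)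
open import Data.Vec using (here; there; lookup; tabulate; replicate)
open import Data.Vec.Properties using (lookup∘tabulate)
open import Data.List using (List; []; _∷_; map; filter; allFin)
open import Data.List.Relation.Unary.Any using (here; there)
open import Data.List.Relation.Unary.All as All using ()
open import Data.List.Membership.Propositional using () renaming (_∈_ to _∈ˡ_)
import Data.List.Membership.DecPropositional as DecMembership
open import Data.List.Membership.Propositional.Properties using (∈-map⁺; ∈-map⁻; ∈-filter⁺; ∈-filter⁻; ∈-allFin)
open import Data.Rational using (ℚ; 0ℚ; 1ℚ; _+_; _-_; -_) renaming (_<_ to _<ℚ_; _≤_ to _≤ℚ_)
import Data.Rational.Properties as ℚ
open import Data.Unit using (⊤)
open import Data.Empty using (⊥-elim)
open import Data.Product using (Σ; ∃; _×_; _,_; proj₁; proj₂)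
open import Data.Sum using (_⊎_; inj₁; inj₂; [_,_]′)
open import Function using (id; _∘_)
open import Level using (0ℓ)
open import Relation.Binary using (DecTotalOrder; IsStrictTotalOrder; tri<; tri≈; tri>)
open import Relation.Binary.PropositionalEquality using (_≡_; refl; sym; trans; cong; subst; subst₂)
open import Relation.Nullary using (Dec; yes; no; Irrelevant)
open import Relation.Unary using (Pred; Decidable; _⊆_; _∪_; _∩_; ｛_｝; U)
open import Relation.Unary.Properties using (_∩?_; _∪?_)
open import Data.List.Extrema (DecTotalOrder.totalOrder ℚ.≤-decTotalOrder) using (min; max; min≤xs; xs≤max; argmin-sel; argmax-sel)

∈-irrelevant : ∀ {m} {S : Subset m} {x : Fin m} → Irrelevant (x ∈ S)
∈-irrelevant here      here      = refl
∈-irrelevant (there p) (there q) = cong there (∈-irrelevant p q)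

p<p+1 : ∀ p → p <ℚ p + 1ℚ
p<p+1 p = subst (_<ℚ p + 1ℚ) (ℚ.+-identityʳ p) (ℚ.+-monoʳ-< p (ℚ.positive⁻¹ 1ℚ))

p-1<p : ∀ p → p - 1ℚ <ℚ p
p-1<p p = subst (p - 1ℚ <ℚ_) (ℚ.+-identityʳ p) (ℚ.+-monoʳ-< p (ℚ.negative⁻¹ (- 1ℚ)))

record Separation (L R : List ℚ) : Set where
  field
    lo hi : ℚ
    lo<hi : lo <ℚ hi
    L≤lo  : ∀ {l} → l ∈ˡ L → l ≤ℚ lo
    hi≤R  : ∀ {r} → r ∈ˡ R → hi ≤ℚ r

separate : (L R : List ℚ) → (∀ {l r} → l ∈ˡ L → r ∈ˡ R → l <ℚ r) → Separation L R
separate L R L<R = record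
  { lo = lo ; hi = hi ; lo<hi = lo<hi
  ; L≤lo = All.lookup (xs≤max base L) ; hi≤R = All.lookup (min≤xs (lo + 1ℚ) R) }
  where
  base lo hi : ℚ
  base = min 0ℚ R - 1ℚ
  lo   = max base L
  hi   = min (lo + 1ℚ) R

  base<R : ∀ {r} → r ∈ˡ R → base <ℚ r
  base<R r∈R = ℚ.<-≤-trans (p-1<p (min 0ℚ R)) (All.lookup (min≤xs 0ℚ R) r∈R)

  lo<R : ∀ {r} → r ∈ˡ R → lo <ℚ r
  lo<R {r} r∈R with argmax-sel id base L
  ... | inj₁ lo≡base = subst (_<ℚ r) (sym lo≡base) (base<R r∈R)
  ... | inj₂ lo∈L    = L<R lo∈L r∈R

  lo<hi : lo <ℚ hi
  lo<hi with argmin-sel id (lo + 1ℚ) R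
  ... | inj₁ hi≡lo+1 = subst (lo <ℚ_) (sym hi≡lo+1) (p<p+1 lo)
  ... | inj₂ hi∈R    = lo<R hi∈R

dense-box : ∀ {n} {D : Point n → Set} → Dense D → (lo hi : Fin n → ℚ) → (∀ i → lo i <ℚ hi i) →
            ∃ λ d → D d × (∀ i → lo i <ℚ lookup d i × lookup d i <ℚ hi i)
dense-box dense lo hi lo<hi =
  let d , d∈D , d∈box = dense (tabulate lo) (tabulate hi) box-nonempty in
  d , d∈D , λ i →
    subst (_<ℚ lookup d i) (lookup∘tabulate lo i) (proj₁ (d∈box i)) ,
    subst (lookup d i <ℚ_) (lookup∘tabulate hi i) (proj₂ (d∈box i))
  where
  box-nonempty : ∀ i → lookup (tabulate lo) i <ℚ lookup (tabulate hi) i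
  box-nonempty i = subst₂ _<ℚ_ (sym (lookup∘tabulate lo i)) (sym (lookup∘tabulate hi i)) (lo<hi i)

module _ {n : ℕ} (Q : POn n) (D : Point n → Set) where

  private
    N : ℕ
    N = size Q

    _⊏[_]_ : Fin N → Fin n → Fin N → Set
    y ⊏[ i ] z = _<[_]_ Q y i z

    module Realizer (i : Fin n) = IsStrictTotalOrder (isSTO Q i)

    _⊏?[_]_ : ∀ y i z → Dec (y ⊏[ i ] z)
    y ⊏?[ i ] z = Realizer._<?_ i y z

    _∈ˡ?_ : ∀ y (xs : List (Fin N)) → Dec (y ∈ˡ xs)
    _∈ˡ?_ = DecMembership._∈?_ _≟_

  record PreservesRealizersOn (Dom : Pred (Fin N) 0ℓ) (h : Fin N → Point n) : Set where
    field
      inD       : ∀ {y} → Dom y → D (h y)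
      preserves : ∀ {y z} → Dom y → Dom z → ∀ i → y ⊏[ i ] z → h y <[ i ]ₚ h z

  preservesRealizersOn-⊆ : ∀ {Dom Dom′ h} → Dom′ ⊆ Dom →
                           PreservesRealizersOn Dom h → PreservesRealizersOn Dom′ h
  preservesRealizersOn-⊆ Dom′⊆Dom p = record
    { inD       = inD ∘ Dom′⊆Dom
    ; preserves = λ dy dz → preserves (Dom′⊆Dom dy) (Dom′⊆Dom dz)
    }
    where open PreservesRealizersOn p

  module _ {Dom : Pred (Fin N) 0ℓ} {h : Fin N → Point n} (p : PreservesRealizersOn Dom h) where
    open PreservesRealizersOn p

    reflects-≤ : ∀ {y z} → Dom y → Dom z → ∀ i →
                 lookup (h y) i ≤ℚ lookup (h z) i → y ≡ z ⊎ y ⊏[ i ] z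
    reflects-≤ {y} {z} dy dz i hy≤hz with Realizer.compare i y z
    ... | tri< y⊏z _ _ = inj₂ y⊏z
    ... | tri≈ _ y≡z _ = inj₁ y≡z
    ... | tri> _ _ z⊏y = ⊥-elim (ℚ.<-irrefl refl (ℚ.<-≤-trans (preserves dz dy i z⊏y) hy≤hz))

    reflects : ∀ {y z} → Dom y → Dom z → ∀ i → h y <[ i ]ₚ h z → y ⊏[ i ] z
    reflects dy dz i hy<hz with reflects-≤ dy dz i (ℚ.<⇒≤ hy<hz)
    ... | inj₁ refl = ⊥-elim (ℚ.<-irrefl refl hy<hz)
    ... | inj₂ y⊏z  = y⊏z

    injective : Fin n → ∀ {y z} → Dom y → Dom z → h y ≡ h z → y ≡ z
    injective i dy dz hy≡hz with reflects-≤ dy dz i (ℚ.≤-reflexive (cong (λ v → lookup v i) hy≡hz))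
    ... | inj₁ y≡z = y≡z
    ... | inj₂ y⊏z = ⊥-elim (ℚ.<⇒≢ (preserves dy dz i y⊏z) (cong (λ v → lookup v i) hy≡hz))

    toEmbedding : Fin n → IsEmbeddingOn Q D Dom (λ y _ → h y)
    toEmbedding i₀ =
      (λ _ → inD) , (λ _ _ → injective i₀) ,
      (λ _ _ dy dz → ≺⇒<ₚ dy dz , <ₚ⇒≺ dy dz) , (λ _ _ dy dz i → preserves dy dz i , reflects dy dz i)
      where
      ≺⇒<ₚ : ∀ {y z} → Dom y → Dom z → _≺_ Q y z → h y <ₚ h z
      ≺⇒<ₚ dy dz y≺z =
        (λ i → ℚ.<⇒≤ (preserves dy dz i (y≺z i))) ,
        (λ hy≡hz → Realizer.irrefl i₀ (injective i₀ dy dz hy≡hz) (y≺z i₀))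

      <ₚ⇒≺ : ∀ {y z} → Dom y → Dom z → h y <ₚ h z → _≺_ Q y z
      <ₚ⇒≺ dy dz (hy≤hz , hy≢hz) i =
        [ (λ y≡z → ⊥-elim (hy≢hz (cong h y≡z))) , id ]′ (reflects-≤ dy dz i (hy≤hz i))

  module _ {Dom : Pred (Fin N) 0ℓ} (Dom? : Decidable Dom) {h : Fin N → Point n}
           (p : PreservesRealizersOn Dom h) where
    open PreservesRealizersOn p

    coordinatesOn : Fin n → {P : Pred (Fin N) 0ℓ} → Decidable P → List ℚ
    coordinatesOn i P? = map (λ y → lookup (h y) i) (filter (Dom? ∩? P?) (allFin N))

    module _ {i : Fin n} {P : Pred (Fin N) 0ℓ} {P? : Decidable P} where

      ∈-coordinatesOn⁺ : ∀ {y} → Dom y → P y → lookup (h y) i ∈ˡ coordinatesOn i P?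
      ∈-coordinatesOn⁺ dy py = ∈-map⁺ _ (∈-filter⁺ (Dom? ∩? P?) (∈-allFin _) (dy , py))

      ∈-coordinatesOn⁻ : ∀ {q} → q ∈ˡ coordinatesOn i P? → ∃ λ y → (Dom ∩ P) y × q ≡ lookup (h y) i
      ∈-coordinatesOn⁻ q∈ with ∈-map⁻ _ q∈
      ... | y , y∈ , q≡hy = y , proj₂ (∈-filter⁻ (Dom? ∩? P?) y∈) , q≡hy

    fittingPoint : Dense D → ∀ x → ∃ λ d → D d ×
                   (∀ {y} → Dom y → ∀ i → (y ⊏[ i ] x → h y <[ i ]ₚ d) × (x ⊏[ i ] y → d <[ i ]ₚ h y))
    fittingPoint dense x =
      let d , d∈D , d∈box = dense-box dense Gap.lo Gap.hi Gap.lo<hi in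
      d , d∈D , λ dy i →
        (λ y⊏x → ℚ.≤-<-trans (Gap.L≤lo i (∈-coordinatesOn⁺ dy y⊏x)) (proj₁ (d∈box i))) ,
        (λ x⊏y → ℚ.<-≤-trans (proj₂ (d∈box i)) (Gap.hi≤R i (∈-coordinatesOn⁺ dy x⊏y)))
      where
      below above : Fin n → List ℚ
      below i = coordinatesOn i (_⊏?[ i ] x)
      above i = coordinatesOn i (x ⊏?[ i ]_)

      below<above : ∀ i {l r} → l ∈ˡ below i → r ∈ˡ above i → l <ℚ r
      below<above i l∈ r∈ with ∈-coordinatesOn⁻ l∈ | ∈-coordinatesOn⁻ r∈
      ... | y , (dy , y⊏x) , refl | z , (dz , x⊏z) , refl = preserves dy dz i (Realizer.trans i y⊏x x⊏z)

      module Gap (i : Fin n) = Separation (separate (below i) (above i) (below<above i))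

    extendAt : Dense D → ∀ x → ∃ λ h′ → PreservesRealizersOn (｛ x ｝ ∪ Dom) h′ × (∀ {y} → Dom y → h′ y ≡ h y)
    extendAt dense x with Dom? x | fittingPoint dense x
    ... | yes dx | _ = h , preservesRealizersOn-⊆ [ (λ { refl → dx }) , id ]′ p , λ _ → refl
    ... | no ¬dx | d , d∈D , fits = h′ , record { inD = inD′ ; preserves = preserves′ } , h′-old
      where
      h′ : Fin N → Point n
      h′ y with x ≟ y
      ... | yes _ = d
      ... | no  _ = h y

      h′-new : h′ x ≡ d
      h′-new with x ≟ x
      ... | yes _   = refl
      ... | no  x≢x = ⊥-elim (x≢x refl)

      h′-old : ∀ {y} → Dom y → h′ y ≡ h y
      h′-old {y} dy with x ≟ y
      ... | yes refl = ⊥-elim (¬dx dy)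
      ... | no  _    = refl

      inD′ : ∀ {y} → (｛ x ｝ ∪ Dom) y → D (h′ y)
      inD′ (inj₁ refl) = subst D (sym h′-new) d∈D
      inD′ (inj₂ dy)   = subst D (sym (h′-old dy)) (inD dy)

      preserves′ : ∀ {y z} → (｛ x ｝ ∪ Dom) y → (｛ x ｝ ∪ Dom) z → ∀ i → y ⊏[ i ] z → h′ y <[ i ]ₚ h′ z
      preserves′ (inj₁ refl) (inj₁ refl) i x⊏x = ⊥-elim (Realizer.irrefl i refl x⊏x)
      preserves′ (inj₁ refl) (inj₂ dz)   i x⊏z rewrite h′-new | h′-old dz = proj₂ (fits dz i) x⊏z
      preserves′ (inj₂ dy)   (inj₁ refl) i y⊏x rewrite h′-old dy | h′-new = proj₁ (fits dy i) y⊏x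
      preserves′ (inj₂ dy)   (inj₂ dz)   i y⊏z rewrite h′-old dy | h′-old dz = preserves dy dz i y⊏z

  extendAlong : Dense D → ∀ {Dom h} → Decidable Dom → PreservesRealizersOn Dom h → (xs : List (Fin N)) →
                ∃ λ h′ → PreservesRealizersOn ((_∈ˡ xs) ∪ Dom) h′ × (∀ {y} → Dom y → h′ y ≡ h y)
  extendAlong dense {h = h} Dom? p [] = h , preservesRealizersOn-⊆ [ (λ ()) , id ]′ p , λ _ → refl
  extendAlong dense Dom? p (x ∷ xs) with extendAlong dense Dom? p xs
  ... | h₁ , p₁ , h₁-agrees with extendAt ((_∈ˡ? xs) ∪? Dom?) p₁ dense x
  ... | h₂ , p₂ , h₂-agrees =
    h₂ , preservesRealizersOn-⊆ split p₂ , λ dy → trans (h₂-agrees (inj₂ dy)) (h₁-agrees dy)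
    where
    split : (_∈ˡ x ∷ xs) ∪ _ ⊆ ｛ x ｝ ∪ ((_∈ˡ xs) ∪ _)
    split (inj₁ (here refl)) = inj₁ refl
    split (inj₁ (there y∈))  = inj₂ (inj₁ y∈)
    split (inj₂ dy)          = inj₂ (inj₂ dy)

  extend : Dense D → ∀ {Dom h} → Decidable Dom → PreservesRealizersOn Dom h →
           ∃ λ g → PreservesRealizersOn U g × (∀ {y} → Dom y → g y ≡ h y)
  extend dense Dom? p =
    let g , g-preserves , g-agrees = extendAlong dense Dom? p (allFin N) in
    g , preservesRealizersOn-⊆ (λ {y} _ → inj₁ (∈-allFin y)) g-preserves , g-agrees

  module _ (S : Subset N) (f : (x : Fin N) → x ∈ S → Point n) where

    totalise : Fin N → Point n
    totalise x with x ∈? S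
    ... | yes x∈S = f x x∈S
    ... | no  _   = replicate n 0ℚ

    totalise-agrees : ∀ {x} (x∈S : x ∈ S) → totalise x ≡ f x x∈S
    totalise-agrees {x} x∈S with x ∈? S
    ... | yes x∈S′ = cong (f x) (∈-irrelevant x∈S′ x∈S)
    ... | no  x∉S  = ⊥-elim (x∉S x∈S)

    embedding⇒preservesRealizers : IsEmbeddingOn Q D (_∈ S) f → PreservesRealizersOn (_∈ S) totalise
    embedding⇒preservesRealizers (f∈D , _ , _ , f-realizers) = record
      { inD       = λ {x} x∈S → subst D (sym (totalise-agrees x∈S)) (f∈D x x∈S)
      ; preserves = λ {y} {z} y∈S z∈S i y⊏z →
          subst₂ (λ u v → u <[ i ]ₚ v) (sym (totalise-agrees y∈S)) (sym (totalise-agrees z∈S))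
                 (proj₁ (f-realizers y z y∈S z∈S i) y⊏z)
      }

lemma3p1 : (n : ℕ) → 2 ≤ n →
    (D : Point n → Set) → Dense D → NoColinear D →
    (Q : POn n) → (S : Subset (size Q)) → Nonempty S →
    (f : (x : Fin (size Q)) → x ∈ S → Point n) → IsEmbeddingOn Q D (_∈ S) f →
    Σ (Fin (size Q) → Point n) λ g → (IsEmbeddingOn Q D (λ _ → ⊤) (λ x _ → g x) × ((x : Fin (size Q)) (p : x ∈ S) → g x ≡ f x p))
lemma3p1 n 2≤n D dense _ Q S _ f f-embedding =
  let g , g-preserves , g-agrees = extend Q D dense (_∈? S) (embedding⇒preservesRealizers Q D S f f-embedding) in
  g , toEmbedding Q D g-preserves (fromℕ< 2≤n) ,
  λ x x∈S → trans (g-agrees x∈S) (totalise-agrees Q D S f x∈S)
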